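{- Let $\omega\in\widetilde{\mathfrak S}_n$. Then $k_{n+1-j,n+1-i}(\omega^*)=k_{i,j}(\omega)$ for all $i,j\in[n]$ with $i<j$; i.e. the inversion table of $\omega^*$ is the transpose of that of $\omega$.
   Context: $\widetilde{\mathfrak S}_n$ is the group of bijections $\omega:\mathbb Z\to\mathbb Z$ with $\omega(i+n)=\omega(i)+n$ and $\omega(1)+\dots+\omega(n)=n(n+1)/2$. For $i<j$ in $[n]$, $k_{i,j}(\omega)=|\lfloor(\omega^{ -1}(j)-\omega^{ -1}(i))/n\rfloor|$; the collection of these numbers is the inversion table of $\omega$. The involutive automorphism $\omega\mapsto\omega^*$ of $\widetilde{\mathfrak S}_n$ is given by $\omega^*(i)=1-\omega(1-i)$ (equivalently, it is induced by $s_i\mapsto s_{n-i}$ for $i\in[n-1]$, $s_n\mapsto s_n$ on the simple transpositions $s_i=[1,\dots,i+1,i,\dots,n]$, $s_n=[0,2,\dots,n-1,n+1]$). -}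

module Defs where

open import Data.Nat as ℕ using (ℕ; zero; suc)
open import Data.Integer as ℤ using (ℤ; +_; _+_; _-_; -_; ∣_∣; _/ℕ_)
open import Data.Integer.Properties using (+-identityˡ; +-identityʳ; +-assoc; +-inverseʳ; neg-involutive; neg-distrib-+)
open import Function using (_↔_; Inverse)
open import Function.Bundles using (mk↔ₛ′)
open import Relation.Binary.PropositionalEquality using (_≡_; refl; cong; sym; trans)

sum1to : ℕ → (ℤ → ℤ) → ℤ
sum1to zero    f = + 0
sum1to (suc m) f = sum1to m f + f (+ suc m)

record AffPerm (n : ℕ) : Set where
  field
    bij    : ℤ ↔ ℤ
  open Inverse bij public using (to; from)
  field
    period : ∀ i → to (i + + n) ≡ to i + + n
    sumCond : sum1to n to ≡ + ((n ℕ.* suc n) ℕ./ 2)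

-- k_{i,j}(ω) = | ⌊ (ω⁻¹(j) − ω⁻¹(i)) / n ⌋ |   (floor division; _/ℕ_ is floor)
kInv : (n : ℕ) .{{_ : ℕ.NonZero n}} → ℤ ↔ ℤ → ℕ → ℕ → ℕ
kInv n ω i j = ∣ (Inverse.from ω (+ j) - Inverse.from ω (+ i)) /ℕ n ∣

private
  1-1- : ∀ x → (+ 1) - ((+ 1) - x) ≡ x
  1-1- x = trans (cong (λ z → (+ 1) + z) (neg-distrib-+ (+ 1) (- x)))
           (trans (sym (+-assoc (+ 1) (- (+ 1)) (- (- x))))
           (trans (cong (_+ (- (- x))) (+-inverseʳ (+ 1)))
           (trans (+-identityˡ (- (- x))) (neg-involutive x))))

star : ℤ ↔ ℤ → ℤ ↔ ℤ
star ω = mk↔ₛ′ (λ i → (+ 1) - to ((+ 1) - i)) (λ i → (+ 1) - from ((+ 1) - i))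
  (λ y → trans (cong (λ z → (+ 1) - to z) (1-1- (from ((+ 1) - y))))
         (trans (cong (λ z → (+ 1) - z) (strictlyInverseˡ ((+ 1) - y))) (1-1- y)))
  (λ x → trans (cong (λ z → (+ 1) - from z) (1-1- (to ((+ 1) - x))))
         (trans (cong (λ z → (+ 1) - z) (strictlyInverseʳ ((+ 1) - x))) (1-1- x)))
  where open Inverse ω

-- Conjugating by i ↦ 1 - i reverses ℤ, so ω*⁻¹(n+1-k) = 1 - ω⁻¹(k - n) = 1 + n - ω⁻¹(k) by
-- periodicity of ω⁻¹. The differences ω*⁻¹(n+1-i) - ω*⁻¹(n+1-j) and ω⁻¹(j) - ω⁻¹(i) therefore
-- agree, and so do their floor quotients by n.
module Submission where

open import Defs
open import Data.Nat using (ℕ; suc; _≤_; _<_; _∸_; NonZero)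
open import Data.Nat.Properties using (≤-trans; <⇒≤; m≤n⇒m≤1+n)
open import Data.Integer using (ℤ; +_; _+_; _-_; _⊖_; ∣_∣; _/ℕ_)
open import Data.Integer.Properties using (⊖-≥; m-n≡m⊖n)
open import Data.Integer.Tactic.RingSolver using (solve-∀)
open import Function using (_↔_; Inverse)
open import Relation.Binary.PropositionalEquality
  using (_≡_; sym; cong; cong₂; module ≡-Reasoning)
open ≡-Reasoning

[a+b]-b≡a : ∀ a b → (a + b) - b ≡ a
[a+b]-b≡a = solve-∀

[a-b]+b≡a : ∀ a b → (a - b) + b ≡ a
[a-b]+b≡a = solve-∀

1-[1+b-a]≡a-b : ∀ a b → + 1 - ((+ 1 + b) - a) ≡ a - b
1-[1+b-a]≡a-b = solve-∀

[1-[a-c]]-[1-[b-c]]≡b-a : ∀ a b c → (+ 1 - (a - c)) - (+ 1 - (b - c)) ≡ b - a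
[1-[a-c]]-[1-[b-c]]≡b-a = solve-∀

1-[1+n∸k]≡k-n : ∀ n k → k ≤ suc n → + 1 - + (suc n ∸ k) ≡ + k - + n
1-[1+n∸k]≡k-n n k k≤1+n = begin
  + 1 - + (suc n ∸ k)       ≡⟨ cong (+ 1 -_) (sym (⊖-≥ k≤1+n)) ⟩
  + 1 - (suc n ⊖ k)         ≡⟨ cong (+ 1 -_) (sym (m-n≡m⊖n (suc n) k)) ⟩
  + 1 - ((+ 1 + + n) - + k) ≡⟨ 1-[1+b-a]≡a-b (+ k) (+ n) ⟩
  + k - + n                 ∎

module _ (f : ℤ ↔ ℤ) (m : ℤ) (period : ∀ i → Inverse.to f (i + m) ≡ Inverse.to f i + m) where
  open Inverse f

  to-period⁻ : ∀ i → to (i - m) ≡ to i - m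
  to-period⁻ i = begin
    to (i - m)           ≡⟨ sym ([a+b]-b≡a (to (i - m)) m) ⟩
    (to (i - m) + m) - m ≡⟨ cong (_- m) (sym (period (i - m))) ⟩
    to ((i - m) + m) - m ≡⟨ cong (λ z → to z - m) ([a-b]+b≡a i m) ⟩
    to i - m             ∎

  from-period⁻ : ∀ x → from (x - m) ≡ from x - m
  from-period⁻ x = begin
    from (x - m)           ≡⟨ cong (λ z → from (z - m)) (sym (strictlyInverseˡ x)) ⟩
    from (to (from x) - m) ≡⟨ cong from (sym (to-period⁻ (from x))) ⟩
    from (to (from x - m)) ≡⟨ strictlyInverseʳ (from x - m) ⟩
    from x - m             ∎

module _ {n : ℕ} (ω : AffPerm n) where
  open AffPerm ω

  star-from-reflect : ∀ k → k ≤ suc n →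
                      Inverse.from (star bij) (+ (suc n ∸ k)) ≡ + 1 - (from (+ k) - + n)
  star-from-reflect k k≤1+n = begin
    + 1 - from (+ 1 - + (suc n ∸ k)) ≡⟨ cong (λ z → + 1 - from z) (1-[1+n∸k]≡k-n n k k≤1+n) ⟩
    + 1 - from (+ k - + n)           ≡⟨ cong (+ 1 -_) (from-period⁻ bij (+ n) period (+ k)) ⟩
    + 1 - (from (+ k) - + n)         ∎

  kInv-star : .{{_ : NonZero n}} → ∀ i j → i ≤ suc n → j ≤ suc n →
              kInv n (star bij) (suc n ∸ j) (suc n ∸ i) ≡ kInv n bij i j
  kInv-star i j i≤1+n j≤1+n = cong (λ z → ∣ z /ℕ n ∣) (begin
    Inverse.from (star bij) (+ (suc n ∸ i)) - Inverse.from (star bij) (+ (suc n ∸ j))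
      ≡⟨ cong₂ _-_ (star-from-reflect i i≤1+n) (star-from-reflect j j≤1+n) ⟩
    (+ 1 - (from (+ i) - + n)) - (+ 1 - (from (+ j) - + n))
      ≡⟨ [1-[a-c]]-[1-[b-c]]≡b-a (from (+ i)) (from (+ j)) (+ n) ⟩
    from (+ j) - from (+ i) ∎)

proposition2p6 : (n : ℕ) .{{_ : NonZero n}} (ω : AffPerm n) (i j : ℕ) →
                 1 ≤ i → i < j → j ≤ n →
                 kInv n (star (AffPerm.bij ω)) (suc n ∸ j) (suc n ∸ i) ≡ kInv n (AffPerm.bij ω) i j
proposition2p6 n ω i j _ i<j j≤n = kInv-star ω i j i≤1+n j≤1+n
  where
  j≤1+n : j ≤ suc n
  j≤1+n = m≤n⇒m≤1+n j≤n
  i≤1+n : i ≤ suc n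
  i≤1+n = ≤-trans (<⇒≤ i<j) j≤1+n
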